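{- The class $\{D_n:n\in\mathbb{N}\}$ of transitive closures of directed paths is $\le_{\mathrm{sg}}$-complete for $\mathsf{G}\,\mathrm{FO}(<)$, i.e. it belongs to $\mathsf{G}\,\mathrm{FO}(<)$ and every graph class in $\mathsf{G}\,\mathrm{FO}(<)$ is $\le_{\mathrm{sg}}$-reducible to it.
   Context: Graphs are finite directed graphs (possibly with self-loops); a graph class is a set of finite graphs closed under isomorphism. $D_n$ is the graph with vertex set $\{0,\dots,n-1\}$ and edges $(u,v)$ for all $u<v$. For $n\ge1$, $\mathcal{N}_n$ is the structure with universe $\{0,\dots,n\}$ and the usual order. $\mathrm{FO}_k(<)$ denotes first-order formulas with $k$ free variables using equality and $<$ only. A logical labeling scheme is $(\varphi,c)$ with $\varphi\in\mathrm{FO}_{2k}(<)$, $c,k\in\mathbb{N}$; a graph $G$ with $n$ vertices is in $\mathrm{gr}(\varphi,c)$ if there is $\ell\colon V(G)\to\{0,\dots,n^c\}^k$ with $(u,v)\in E(G)\iff\mathcal{N}_{n^c},(\ell(u),\ell(v))\models\varphi$ for all $u,v$. $\mathsf{G}\,\mathrm{FO}(<)$ is the set of graph classes contained in some such $\mathrm{gr}(\varphi,c)$. For a $k^2$-ary boolean function $f$ and a $k\times k$ $0/1$-matrix $A$, $f(A)$ is $f$ applied to the entries of $A$ read row by row. $G$ has an $(H,f)$-representation if there is $\ell\colon V(G)\to V(H)^k$ such that for all distinct $u,v\in V(G)$: $(u,v)\in E(G)\iff f(A^\ell_{uv})=1$, where $(A^\ell_{uv})_{i,j}=1$ iff $(\ell(u)_i,\ell(v)_j)\in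 E(H)$. $\mathcal{C}\le_{\mathrm{sg}}\mathcal{D}$ if there are $c,k\in\mathbb{N}$ and a $k^2$-ary boolean function $f$ such that for all $n$ and every $G\in\mathcal{C}$ with $n$ vertices there is $H\in\mathcal{D}$ with $n^c$ vertices such that $G$ has an $(H,f)$-representation. -}

module Defs where

open import Data.Nat using (ℕ; zero; suc; _+_; _*_; _^_; _<ᵇ_)
open import Data.Bool using (Bool; true; false)
open import Data.Fin using (Fin; toℕ; splitAt)
open import Data.Vec using (Vec; concat; tabulate)
open import Data.Product using (Σ; _×_; _,_)
open import Data.Sum using (_⊎_; [_,_]′)
open import Relation.Binary.PropositionalEquality using (_≡_)
open import Relation.Nullary using (¬_)
open import Function.Bundles using (_↔_; _⇔_; Inverse)

record Graph : Set where
  field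
    size : ℕ
    edge : Fin size → Fin size → Bool
open Graph public

_≅_ : Graph → Graph → Set
G ≅ H = Σ (Fin (size G) ↔ Fin (size H)) λ f →
          ∀ u v → edge G u v ≡ edge H (Inverse.to f u) (Inverse.to f v)

IsGraphClass : (Graph → Set) → Set
IsGraphClass C = ∀ G H → G ≅ H → C G → C H

D : ℕ → Graph
D n = record { size = n ; edge = λ u v → toℕ u <ᵇ toℕ v }

DClass : Graph → Set
DClass G = Σ ℕ λ n → G ≅ D n

data Formula (k : ℕ) : Set where
  _≐_ : Fin k → Fin k → Formula k
  _⋖_ : Fin k → Fin k → Formula k
  ¬ᶠ_ : Formula k → Formula k
  _∧ᶠ_ : Formula k → Formula k → Formula k
  _∨ᶠ_ : Formula k → Formula k → Formula k
  ∃ᶠ : Formula (suc k) → Formula k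
  ∀ᶠ : Formula (suc k) → Formula k

extend : ∀ {A : Set} {k} → A → (Fin k → A) → Fin (suc k) → A
extend a ρ Fin.zero = a
extend a ρ (Fin.suc i) = ρ i

Sat : (m : ℕ) → ∀ {k} → (Fin k → Fin (suc m)) → Formula k → Set
Sat m ρ (x ≐ y) = ρ x ≡ ρ y
Sat m ρ (x ⋖ y) = (toℕ (ρ x) <ᵇ toℕ (ρ y)) ≡ true
Sat m ρ (¬ᶠ φ) = ¬ Sat m ρ φ
Sat m ρ (φ ∧ᶠ ψ) = Sat m ρ φ × Sat m ρ ψ
Sat m ρ (φ ∨ᶠ ψ) = Sat m ρ φ ⊎ Sat m ρ ψ
Sat m ρ (∃ᶠ φ) = Σ (Fin (suc m)) λ a → Sat m (extend a ρ) φ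
Sat m ρ (∀ᶠ φ) = (a : Fin (suc m)) → Sat m (extend a ρ) φ

-- The 2k-tuple (ℓ(u), ℓ(v)) as an assignment to variables Fin (k + k).
pairEnv : ∀ {A : Set} k → (Fin k → A) → (Fin k → A) → Fin (k + k) → A
pairEnv k a b i = [ a , b ]′ (splitAt k i)

InGr : ∀ {k} → Formula (k + k) → ℕ → Graph → Set
InGr {k} φ c G =
  Σ (Fin (size G) → Fin k → Fin (suc (size G ^ c))) λ ℓ →
    ∀ u v → (edge G u v ≡ true) ⇔ Sat (size G ^ c) (pairEnv k (ℓ u) (ℓ v)) φ

InGFO : (Graph → Set) → Set
InGFO C = Σ ℕ λ k → Σ (Formula (k + k)) λ φ → Σ ℕ λ c →
            ∀ G → C G → InGr {k} φ c G

rowsOf : ∀ {k} → (Fin k → Fin k → Bool) → Vec Bool (k * k)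
rowsOf A = concat (tabulate λ i → tabulate λ j → A i j)

HasRep : (G H : Graph) (k : ℕ) → (Vec Bool (k * k) → Bool) → Set
HasRep G H k f =
  Σ (Fin (size G) → Fin k → Fin (size H)) λ ℓ →
    ∀ u v → ¬ (u ≡ v) →
      (edge G u v ≡ true) ⇔ (f (rowsOf (λ i j → edge H (ℓ u i) (ℓ v j))) ≡ true)

_≤sg_ : (Graph → Set) → (Graph → Set) → Set
C ≤sg E = Σ ℕ λ c → Σ ℕ λ k → Σ (Vec Bool (k * k) → Bool) λ f →
            ∀ G → C G → Σ Graph λ H → E H × (size H ≡ size G ^ c) × HasRep G H k f

-- Over the linear order {0,…,m}, whether a formula of quantifier rank q holds at a tuple depends only
-- on the gaps between its entries and the endpoints 0 and m, each clipped at 2^q: a new element is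
-- either within 2^(q-1) of an old point, and then named exactly by that point and an offset, or it is
-- farther from all of them, and then it may be moved to 2^(q-1) above the greatest point below it.
-- So the edge relation of G ∈ gr(φ,c) is a function of the clipped gaps within and between the labels
-- of u and v. Each label becomes polynomially many numbers below n^(c+2^q+1): its entries shifted by
-- 0,…,2^q and its own clipped gaps. Every clipped gap is then a count of true comparisons
-- "number of u < number of v", i.e. of edges of a transitive tournament D_N.
module Submission where

open import Defs
open import Data.Nat
open import Data.Nat.Properties
open import Data.Bool using (Bool; true; not; if_then_else_)
open import Data.Bool.Properties using (T-≡)
open import Data.Empty using (⊥; ⊥-elim)
open import Data.Unit using (⊤; tt)
open import Data.Fin using (Fin; toℕ; fromℕ<; fromℕ; splitAt; combine; inject₁; _↑ˡ_; _↑ʳ_)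
  renaming (zero to fz; suc to fs)
open import Data.Fin.Properties
  using (toℕ<n; toℕ≤pred[n]; toℕ-fromℕ<; toℕ-fromℕ; toℕ-inject₁; toℕ-injective; splitAt-↑ˡ; splitAt-↑ʳ;
         +↔⊎; *↔×; any?; all?)
open import Data.Fin.Permutation using (↔⇒≡)
open import Data.Product using (Σ; ∃; ∃-syntax; _×_; _,_; proj₁; proj₂)
open import Data.Product.Function.NonDependent.Propositional using (_×-⇔_)
open import Data.Sum using (_⊎_; inj₁; inj₂; [_,_]′)
open import Data.Sum.Function.Propositional using (_⊎-⇔_; _⊎-↔_)
open import Data.Vec using (Vec; lookup; tabulate)
open import Data.Vec.Properties using (lookup-concat; lookup∘tabulate)
open import Function using (_∘_; id)
open import Function.Bundles using (_⇔_; mk⇔; Equivalence; _↔_; Inverse)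
open import Function.Properties.Equivalence using () renaming (trans to ⇔-trans; sym to ⇔-sym)
open import Function.Properties.Inverse using (↔-refl; ↔-trans)
open import Function.Related.TypeIsomorphisms using (¬-cong-⇔)
open import Relation.Binary.PropositionalEquality
open import Relation.Nullary using (¬_; Dec; yes; no)
open import Relation.Nullary.Decidable using (does; map′; _×-dec_; _⊎-dec_; _→-dec_; ¬?)

-- The k variables followed by the two endpoints, 0 and m.
Point : ℕ → Set
Point k = Fin (k + 2)

var : ∀ {k} → Fin k → Point k
var x = x ↑ˡ 2

bottom top : ∀ {k} → Point k
bottom {k} = k ↑ʳ fz
top {k} = k ↑ʳ fs fz

endpoint : ℕ → Fin 2 → ℕ
endpoint m fz = 0
endpoint m (fs fz) = m

position : ∀ m {k} → (Fin k → Fin (suc m)) → Point k → ℕ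
position m {k} ρ p = [ toℕ ∘ ρ , endpoint m ]′ (splitAt k p)

position-var : ∀ m {k} (ρ : Fin k → Fin (suc m)) x → position m ρ (var x) ≡ toℕ (ρ x)
position-var m {k} ρ x rewrite splitAt-↑ˡ k x 2 = refl

position-endpoint : ∀ m {k} (ρ : Fin k → Fin (suc m)) e → position m ρ (k ↑ʳ e) ≡ endpoint m e
position-endpoint m {k} ρ e rewrite splitAt-↑ʳ k 2 e = refl

position-bottom : ∀ m {k} (ρ : Fin k → Fin (suc m)) → position m ρ bottom ≡ 0
position-bottom m ρ = position-endpoint m ρ fz

position-top : ∀ m {k} (ρ : Fin k → Fin (suc m)) → position m ρ top ≡ m
position-top m ρ = position-endpoint m ρ (fs fz)

position-≤ : ∀ m {k} (ρ : Fin k → Fin (suc m)) p → position m ρ p ≤ m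
position-≤ m {k} ρ p with splitAt k p
... | inj₁ x = s≤s⁻¹ (toℕ<n (ρ x))
... | inj₂ fz = z≤n
... | inj₂ (fs fz) = ≤-refl

position-extend : ∀ m {k} (a : Fin (suc m)) (ρ : Fin k → Fin (suc m)) p →
                  position m (extend a ρ) p ≡ extend (toℕ a) (position m ρ) p
position-extend m a ρ fz = refl
position-extend m {k} a ρ (fs p) with splitAt k p
... | inj₁ x = refl
... | inj₂ e = refl

Profile : ℕ → Set
Profile n = Fin n → Fin n → ℕ

_≗₂_ : ∀ {n} → Profile n → Profile n → Set
D ≗₂ E = ∀ p q → D p q ≡ E p q

gaps : ∀ {n} → ℕ → (Fin n → ℕ) → Profile n
gaps T x p q = T ⊓ (x q ∸ x p)

gaps-cong : ∀ {n} T {x y : Fin n → ℕ} → (∀ p → x p ≡ y p) → gaps T x ≗₂ gaps T y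
gaps-cong T x≗y p q = cong₂ (λ a b → T ⊓ (a ∸ b)) (x≗y q) (x≗y p)

⊓-⊓-absorb : ∀ {T' T} z → T' ≤ T → T' ⊓ (T ⊓ z) ≡ T' ⊓ z
⊓-⊓-absorb {T'} {T} z T'≤T = trans (sym (⊓-assoc T' T z)) (cong (_⊓ z) (m≤n⇒m⊓n≡m T'≤T))

⊓-∸-absorb : ∀ {T' T d} z → T' + d ≤ T → T' ⊓ (z ∸ d) ≡ T' ⊓ (T ⊓ z ∸ d)
⊓-∸-absorb {T'} {T} {d} z T'+d≤T with ≤-total z T
... | inj₁ z≤T = cong (λ w → T' ⊓ (w ∸ d)) (sym (m≥n⇒m⊓n≡n z≤T))
... | inj₂ T≤z = begin
  T' ⊓ (z ∸ d)      ≡⟨ m≤n⇒m⊓n≡m (≤-trans T'≤T∸d (∸-monoˡ-≤ d T≤z)) ⟩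
  T'                ≡⟨ sym (m≤n⇒m⊓n≡m T'≤T∸d) ⟩
  T' ⊓ (T ∸ d)      ≡⟨ cong (λ w → T' ⊓ (w ∸ d)) (sym (m≤n⇒m⊓n≡m T≤z)) ⟩
  T' ⊓ (T ⊓ z ∸ d)  ∎
  where
  open ≡-Reasoning
  T'≤T∸d : T' ≤ T ∸ d
  T'≤T∸d = m+n≤o⇒m≤o∸n T' T'+d≤T

⊓-+-absorb : ∀ {T' T} z d → T' ≤ T → T' ⊓ (z + d) ≡ T' ⊓ (T ⊓ z + d)
⊓-+-absorb {T'} {T} z d T'≤T with ≤-total z T
... | inj₁ z≤T = cong (λ w → T' ⊓ (w + d)) (sym (m≥n⇒m⊓n≡n z≤T))
... | inj₂ T≤z = begin
  T' ⊓ (z + d)      ≡⟨ m≤n⇒m⊓n≡m (≤-trans T'≤T (≤-trans T≤z (m≤m+n z d))) ⟩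
  T'                ≡⟨ sym (m≤n⇒m⊓n≡m (≤-trans T'≤T (m≤m+n T d))) ⟩
  T' ⊓ (T + d)      ≡⟨ cong (λ w → T' ⊓ (w + d)) (sym (m≤n⇒m⊓n≡m T≤z)) ⟩
  T' ⊓ (T ⊓ z + d)  ∎
  where open ≡-Reasoning

∸-⊓-absorb : ∀ {T d} z → d ≤ T → d ∸ z ≡ d ∸ T ⊓ z
∸-⊓-absorb {T} {d} z d≤T with ≤-total z T
... | inj₁ z≤T = cong (d ∸_) (sym (m≥n⇒m⊓n≡n z≤T))
... | inj₂ T≤z = begin
  d ∸ z      ≡⟨ m≤n⇒m∸n≡0 (≤-trans d≤T T≤z) ⟩
  0          ≡⟨ sym (m≤n⇒m∸n≡0 d≤T) ⟩
  d ∸ T      ≡⟨ cong (d ∸_) (sym (m≤n⇒m⊓n≡m T≤z)) ⟩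
  d ∸ T ⊓ z  ∎
  where open ≡-Reasoning

⊓-∸-≡0 : ∀ T {a b} → a ≤ b → T ⊓ (a ∸ b) ≡ 0
⊓-∸-≡0 T a≤b = trans (cong (T ⊓_) (m≤n⇒m∸n≡0 a≤b)) (⊓-zeroʳ T)

-- Holds because one of x ∸ y and y ∸ x vanishes.
⊓-shift-absorb : ∀ {T' T d} x y → d ≤ T → T' ≤ T →
                 T' ⊓ (x + d ∸ y) ≡ T' ⊓ (T ⊓ (x ∸ y) + d ∸ T ⊓ (y ∸ x))
⊓-shift-absorb {T'} {T} {d} x y d≤T T'≤T with ≤-total y x
... | inj₁ y≤x = begin
  T' ⊓ (x + d ∸ y)                          ≡⟨ cong (T' ⊓_) (+-∸-comm d y≤x) ⟩
  T' ⊓ (x ∸ y + d)                          ≡⟨ ⊓-+-absorb (x ∸ y) d T'≤T ⟩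
  T' ⊓ (T ⊓ (x ∸ y) + d)                    ≡⟨ cong (λ w → T' ⊓ (T ⊓ (x ∸ y) + d ∸ w)) (sym (⊓-∸-≡0 T y≤x)) ⟩
  T' ⊓ (T ⊓ (x ∸ y) + d ∸ T ⊓ (y ∸ x))      ∎
  where open ≡-Reasoning
... | inj₂ x≤y = begin
  T' ⊓ (x + d ∸ y)                          ≡⟨ cong (λ w → T' ⊓ (x + d ∸ w)) (sym (m+[n∸m]≡n x≤y)) ⟩
  T' ⊓ (x + d ∸ (x + (y ∸ x)))              ≡⟨ cong (T' ⊓_) ([m+n]∸[m+o]≡n∸o x d (y ∸ x)) ⟩
  T' ⊓ (d ∸ (y ∸ x))                        ≡⟨ cong (T' ⊓_) (∸-⊓-absorb (y ∸ x) d≤T) ⟩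
  T' ⊓ (d ∸ T ⊓ (y ∸ x))                    ≡⟨ cong (λ w → T' ⊓ (w + d ∸ T ⊓ (y ∸ x))) (sym (⊓-∸-≡0 T x≤y)) ⟩
  T' ⊓ (T ⊓ (x ∸ y) + d ∸ T ⊓ (y ∸ x))      ∎
  where open ≡-Reasoning

∸-∸-comm : ∀ x y d → x ∸ d ∸ y ≡ x ∸ y ∸ d
∸-∸-comm x y d = begin
  x ∸ d ∸ y    ≡⟨ ∸-+-assoc x d y ⟩
  x ∸ (d + y)  ≡⟨ cong (x ∸_) (+-comm d y) ⟩
  x ∸ (y + d)  ≡⟨ sym (∸-+-assoc x y d) ⟩
  x ∸ y ∸ d    ∎
  where open ≡-Reasoning

∸-∸-undo : ∀ y {x d} → d ≤ x → y ∸ (x ∸ d) ≡ y + d ∸ x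
∸-∸-undo y {x} {d} d≤x = begin
  y ∸ (x ∸ d)              ≡⟨ sym ([m+n]∸[m+o]≡n∸o d y (x ∸ d)) ⟩
  d + y ∸ (d + (x ∸ d))    ≡⟨ cong₂ _∸_ (+-comm d y) (m+[n∸m]≡n d≤x) ⟩
  y + d ∸ x                ∎
  where open ≡-Reasoning

data Dir : Set where
  ↑ ↓ : Dir

Candidate : ℕ → ℕ → Set
Candidate n T = Fin n × Fin (suc T) × Dir

value : ∀ {n T} → (Fin n → ℕ) → Candidate n T → ℕ
value x (p , d , ↑) = x p + toℕ d
value x (p , d , ↓) = x p ∸ toℕ d

NoUnderflow : ∀ {n T} → (Fin n → ℕ) → Candidate n T → Set
NoUnderflow x (p , d , ↑) = ⊤
NoUnderflow x (p , d , ↓) = toℕ d ≤ x p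

towards awayFrom : ∀ {n T} → Profile n → Candidate n T → Fin n → ℕ
towards D (i , d , ↑) p = D p i + toℕ d ∸ D i p
towards D (i , d , ↓) p = D p i ∸ toℕ d
awayFrom D (i , d , ↑) q = D i q ∸ toℕ d
awayFrom D (i , d , ↓) q = D i q + toℕ d ∸ D q i

extendProfile : ∀ {n T} → Profile n → Candidate n T → Profile (suc n)
extendProfile D c fz fz = 0
extendProfile {T = T} D c fz (fs q) = T ⊓ awayFrom D c q
extendProfile {T = T} D c (fs p) fz = T ⊓ towards D c p
extendProfile {T = T} D c (fs p) (fs q) = T ⊓ D p q

module _ {T' T : ℕ} (2T'≤T : T' + T' ≤ T) where

  private
    T'≤T : T' ≤ T
    T'≤T = ≤-trans (m≤m+n T' T') 2T'≤T

    offset≤T : (d : Fin (suc T')) → toℕ d ≤ T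
    offset≤T d = ≤-trans (toℕ≤pred[n] d) T'≤T

    T'+offset≤T : (d : Fin (suc T')) → T' + toℕ d ≤ T
    T'+offset≤T d = ≤-trans (+-monoʳ-≤ T' (toℕ≤pred[n] d)) 2T'≤T

  extendProfile-gaps : ∀ {n} (x : Fin n → ℕ) (c : Candidate n T') → NoUnderflow x c →
                       extendProfile (gaps T x) c ≗₂ gaps T' (extend (value x c) x)
  extendProfile-gaps x c _ fz fz = sym (trans (cong (T' ⊓_) (n∸n≡0 (value x c))) (⊓-zeroʳ T'))
  extendProfile-gaps x c _ (fs p) (fs q) = ⊓-⊓-absorb (x q ∸ x p) T'≤T
  extendProfile-gaps x (i , d , ↑) _ (fs p) fz = sym (⊓-shift-absorb (x i) (x p) (offset≤T d) T'≤T)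
  extendProfile-gaps x (i , d , ↓) _ (fs p) fz =
    trans (sym (⊓-∸-absorb (x i ∸ x p) (T'+offset≤T d))) (cong (T' ⊓_) (sym (∸-∸-comm (x i) (x p) (toℕ d))))
  extendProfile-gaps x (i , d , ↑) _ fz (fs q) =
    trans (sym (⊓-∸-absorb (x q ∸ x i) (T'+offset≤T d))) (cong (T' ⊓_) (∸-+-assoc (x q) (x i) (toℕ d)))
  extendProfile-gaps x (i , d , ↓) d≤xi fz (fs q) =
    trans (sym (⊓-shift-absorb (x q) (x i) (offset≤T d) T'≤T)) (cong (T' ⊓_) (sym (∸-∸-undo (x q) d≤xi)))

extendProfile-cong : ∀ {n T} {D E : Profile n} → D ≗₂ E → (c : Candidate n T) →
                     extendProfile D c ≗₂ extendProfile E c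
extendProfile-cong D≗E c fz fz = refl
extendProfile-cong {T = T} D≗E (i , d , ↑) fz (fs q) = cong (λ w → T ⊓ (w ∸ toℕ d)) (D≗E i q)
extendProfile-cong {T = T} D≗E (i , d , ↓) fz (fs q) = cong₂ (λ a b → T ⊓ (a + toℕ d ∸ b)) (D≗E i q) (D≗E q i)
extendProfile-cong {T = T} D≗E (i , d , ↑) (fs p) fz = cong₂ (λ a b → T ⊓ (a + toℕ d ∸ b)) (D≗E p i) (D≗E i p)
extendProfile-cong {T = T} D≗E (i , d , ↓) (fs p) fz = cong (λ w → T ⊓ (w ∸ toℕ d)) (D≗E p i)
extendProfile-cong {T = T} D≗E c (fs p) (fs q) = cong (T ⊓_) (D≗E p q)

-- Validity keeps the candidate's value within {0,…,m}.
Valid : ∀ {k T} → Profile (k + 2) → Candidate (k + 2) T → Set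
Valid D (p , d , ↑) = toℕ d ≤ D p top
Valid D (p , d , ↓) = toℕ d ≤ D bottom p

valid? : ∀ {k T} (D : Profile (k + 2)) (c : Candidate (k + 2) T) → Dec (Valid D c)
valid? D (p , d , ↑) = toℕ d ≤? D p top
valid? D (p , d , ↓) = toℕ d ≤? D bottom p

Valid-resp : ∀ {k T} {D E : Profile (k + 2)} → D ≗₂ E → (c : Candidate (k + 2) T) → Valid D c → Valid E c
Valid-resp D≗E (p , d , ↑) = subst (toℕ d ≤_) (D≗E p top)
Valid-resp D≗E (p , d , ↓) = subst (toℕ d ≤_) (D≗E bottom p)

SameGaps : ∀ {n} → ℕ → (Fin n → ℕ) → ℕ → ℕ → Set
SameGaps T x v w = ∀ p → T ⊓ (v ∸ x p) ≡ T ⊓ (w ∸ x p) × T ⊓ (x p ∸ v) ≡ T ⊓ (x p ∸ w)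

SameGaps-extend : ∀ {n T} {x : Fin n → ℕ} {v w} → SameGaps T x v w →
                  gaps T (extend v x) ≗₂ gaps T (extend w x)
SameGaps-extend {T = T} {v = v} {w} same fz fz = cong (T ⊓_) (trans (n∸n≡0 v) (sym (n∸n≡0 w)))
SameGaps-extend same fz (fs q) = proj₂ (same q)
SameGaps-extend same (fs p) fz = proj₁ (same p)
SameGaps-extend same (fs p) (fs q) = refl

greatest-≤ : ∀ {n} (f : Fin n → ℕ) A →
             (∃[ i ] f i ≤ A × (∀ j → f j ≤ A → f j ≤ f i)) ⊎ (∀ j → ¬ f j ≤ A)
greatest-≤ {zero} f A = inj₂ λ ()
greatest-≤ {suc n} f A with greatest-≤ (f ∘ fs) A | f fz ≤? A
... | inj₂ none | no ¬0 = inj₂ λ { fz → ¬0 ; (fs j) → none j }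
... | inj₂ none | yes 0≤A = inj₁ (fz , 0≤A , λ { fz _ → ≤-refl ; (fs j) q → ⊥-elim (none j q) })
... | inj₁ (i , i≤A , max) | no ¬0 = inj₁ (fs i , i≤A , λ { fz q → ⊥-elim (¬0 q) ; (fs j) → max j })
... | inj₁ (i , i≤A , max) | yes 0≤A with f fz ≤? f (fs i)
...   | yes 0≤i = inj₁ (fs i , i≤A , λ { fz _ → 0≤i ; (fs j) → max j })
...   | no 0≰i = inj₁ (fz , 0≤A , λ { fz _ → ≤-refl ; (fs j) q → ≤-trans (max j q) (<⇒≤ (≰⇒> 0≰i)) })

far-sameGap : ∀ {T' L A} y → L + T' < A → T' < ∣ A - y ∣ → (y ≤ A → y ≤ L) →
              T' ⊓ (L + T' ∸ y) ≡ T' ⊓ (A ∸ y) × T' ⊓ (y ∸ (L + T')) ≡ T' ⊓ (y ∸ A)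
far-sameGap {T'} {L} {A} y L+T'<A far below with ≤-total y A
... | inj₁ y≤A =
  trans (m≤n⇒m⊓n≡m (≤-trans (≤-reflexive (sym (m+n∸m≡n y T')))
                            (∸-monoˡ-≤ y (+-monoˡ-≤ T' (below y≤A)))))
        (sym (m≤n⇒m⊓n≡m (<⇒≤ (subst (T' <_) (m≤n⇒∣n-m∣≡n∸m y≤A) far)))) ,
  trans (⊓-∸-≡0 T' (≤-trans (below y≤A) (m≤m+n L T'))) (sym (⊓-∸-≡0 T' y≤A))
... | inj₂ A≤y =
  trans (⊓-∸-≡0 T' (<⇒≤ (<-≤-trans L+T'<A A≤y))) (sym (⊓-∸-≡0 T' A≤y)) ,
  trans (m≤n⇒m⊓n≡m (≤-trans T'≤y∸A (∸-monoʳ-≤ y (<⇒≤ L+T'<A)))) (sym (m≤n⇒m⊓n≡m T'≤y∸A))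
  where
  T'≤y∸A : T' ≤ y ∸ A
  T'≤y∸A = <⇒≤ (subst (T' <_) (m≤n⇒∣m-n∣≡n∸m A≤y) far)

module _ (m : ℕ) {k : ℕ} (ρ : Fin k → Fin (suc m)) where

  private
    x : Point k → ℕ
    x = position m ρ

    a≤m : (a : Fin (suc m)) → toℕ a ≤ m
    a≤m a = s≤s⁻¹ (toℕ<n a)

    gap-to-top : ∀ T p → gaps T x p top ≡ T ⊓ (m ∸ x p)
    gap-to-top T p = cong (λ w → T ⊓ (w ∸ x p)) (position-top m ρ)

    gap-from-bottom : ∀ T p → gaps T x bottom p ≡ T ⊓ x p
    gap-from-bottom T p = cong (λ w → T ⊓ (x p ∸ w)) (position-bottom m ρ)

  valid-noUnderflow : ∀ {T T'} (c : Candidate (k + 2) T') → Valid (gaps T x) c → NoUnderflow x c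
  valid-noUnderflow (p , d , ↑) _ = tt
  valid-noUnderflow {T} (p , d , ↓) valid = ≤-trans valid (≤-trans (≤-reflexive (gap-from-bottom T p)) (m⊓n≤n T (x p)))

  valid-value-≤ : ∀ {T T'} (c : Candidate (k + 2) T') → Valid (gaps T x) c → value x c ≤ m
  valid-value-≤ {T} (p , d , ↑) valid = begin
    x p + toℕ d        ≤⟨ +-monoʳ-≤ (x p) (≤-trans valid (≤-trans (≤-reflexive (gap-to-top T p)) (m⊓n≤n T _))) ⟩
    x p + (m ∸ x p)    ≡⟨ m+[n∸m]≡n (position-≤ m ρ p) ⟩
    m                  ∎
    where open ≤-Reasoning
  valid-value-≤ (p , d , ↓) _ = ≤-trans (m∸n≤m (x p) (toℕ d)) (position-≤ m ρ p)

  exact-candidate : ∀ {T' T} → T' ≤ T → (a : Fin (suc m)) (p : Point k) → ∣ toℕ a - x p ∣ ≤ T' →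
                    ∃[ c ] Valid {T = T'} (gaps T x) c × value x c ≡ toℕ a
  exact-candidate {T'} {T} T'≤T a p near with x p ≤? toℕ a
  ... | yes p≤a = (p , d , ↑) , valid , trans (cong (x p +_) toℕ-d) (m+[n∸m]≡n p≤a)
    where
    d≤T' : toℕ a ∸ x p ≤ T'
    d≤T' = subst (_≤ T') (m≤n⇒∣n-m∣≡n∸m p≤a) near
    d = fromℕ< (s≤s d≤T')
    toℕ-d : toℕ d ≡ toℕ a ∸ x p
    toℕ-d = toℕ-fromℕ< (s≤s d≤T')
    valid : toℕ d ≤ gaps T x p top
    valid = subst (toℕ d ≤_) (sym (gap-to-top T p))
              (⊓-glb (≤-trans (toℕ≤pred[n] d) T'≤T) (≤-trans (≤-reflexive toℕ-d) (∸-monoˡ-≤ (x p) (a≤m a))))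
  ... | no p≰a = (p , d , ↓) , valid , trans (cong (x p ∸_) toℕ-d) (m∸[m∸n]≡n a≤p)
    where
    a≤p : toℕ a ≤ x p
    a≤p = <⇒≤ (≰⇒> p≰a)
    d≤T' : x p ∸ toℕ a ≤ T'
    d≤T' = subst (_≤ T') (m≤n⇒∣m-n∣≡n∸m a≤p) near
    d = fromℕ< (s≤s d≤T')
    toℕ-d : toℕ d ≡ x p ∸ toℕ a
    toℕ-d = toℕ-fromℕ< (s≤s d≤T')
    valid : toℕ d ≤ gaps T x bottom p
    valid = subst (toℕ d ≤_) (sym (gap-from-bottom T p))
              (⊓-glb (≤-trans (toℕ≤pred[n] d) T'≤T) (≤-trans (≤-reflexive toℕ-d) (m∸n≤m (x p) (toℕ a))))

  -- Far from every point, a is replaced by the point T' above the greatest point below a.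
  far-candidate : ∀ {T' T} → T' ≤ T → (a : Fin (suc m)) → (∀ p → T' < ∣ toℕ a - x p ∣) →
                  ∃[ c ] Valid {T = T'} (gaps T x) c × SameGaps T' x (value x c) (toℕ a)
  far-candidate {T'} {T} T'≤T a far with greatest-≤ x (toℕ a)
  ... | inj₂ none = ⊥-elim (none bottom (subst (_≤ toℕ a) (sym (position-bottom m ρ)) z≤n))
  ... | inj₁ (l , l≤a , greatest) = (l , fromℕ T' , ↑) , valid , same
    where
    A = toℕ a
    l+T'<a : x l + T' < A
    l+T'<a = begin-strict
      x l + T'        <⟨ +-monoʳ-< (x l) (subst (T' <_) (m≤n⇒∣n-m∣≡n∸m l≤a) (far l)) ⟩
      x l + (A ∸ x l) ≡⟨ m+[n∸m]≡n l≤a ⟩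
      A               ∎
      where open ≤-Reasoning
    valid : toℕ (fromℕ T') ≤ gaps T x l top
    valid = subst₂ _≤_ (sym (toℕ-fromℕ T')) (sym (gap-to-top T l))
              (⊓-glb T'≤T (m+n≤o⇒m≤o∸n T' (≤-trans (≤-reflexive (+-comm T' (x l))) (≤-trans (<⇒≤ l+T'<a) (a≤m a)))))
    same : SameGaps T' x (x l + toℕ (fromℕ T')) A
    same p rewrite toℕ-fromℕ T' = far-sameGap (x p) l+T'<a (far p) (greatest p)

  capture : ∀ {T' T} → T' ≤ T → (a : Fin (suc m)) →
            ∃[ c ] Valid {T = T'} (gaps T x) c × SameGaps T' x (value x c) (toℕ a)
  capture {T'} T'≤T a with any? (λ p → ∣ toℕ a - x p ∣ ≤? T')
  ... | yes (p , near) with exact-candidate T'≤T a p near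
  ...   | c , valid , exact = c , valid , λ q → cong (λ v → T' ⊓ (v ∸ x q)) exact , cong (λ v → T' ⊓ (x q ∸ v)) exact
  capture T'≤T a | no notNear = far-candidate T'≤T a (λ p → ≰⇒> (λ near → notNear (p , near)))

  module _ {T' T : ℕ} (2T'≤T : T' + T' ≤ T) {D : Profile (k + 2)} (D≗gaps : D ≗₂ gaps T x) where

    candidate→point : (c : Candidate (k + 2) T') → Valid D c →
                      ∃[ a ] extendProfile D c ≗₂ gaps T' (position m (extend a ρ))
    candidate→point c valid = a , λ p q → begin
      extendProfile D c p q               ≡⟨ extendProfile-cong D≗gaps c p q ⟩
      extendProfile (gaps T x) c p q      ≡⟨ extendProfile-gaps 2T'≤T x c (valid-noUnderflow c valid′) p q ⟩
      gaps T' (extend (value x c) x) p q  ≡⟨ gaps-cong T' position-a p q ⟨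
      gaps T' (position m (extend a ρ)) p q ∎
      where
      open ≡-Reasoning
      valid′ = Valid-resp D≗gaps c valid
      a = fromℕ< (s≤s (valid-value-≤ c valid′))
      position-a : ∀ r → position m (extend a ρ) r ≡ extend (value x c) x r
      position-a r = trans (position-extend m a ρ r) (cong (λ v → extend v x r) (toℕ-fromℕ< (s≤s (valid-value-≤ c valid′))))

    point→candidate : (a : Fin (suc m)) →
                      ∃[ c ] Valid D c × extendProfile D c ≗₂ gaps T' (position m (extend a ρ))
    point→candidate a with capture (≤-trans (m≤m+n T' T') 2T'≤T) a
    ... | c , valid , same = c , Valid-resp (λ p q → sym (D≗gaps p q)) c valid , λ p q → begin
      extendProfile D c p q               ≡⟨ extendProfile-cong D≗gaps c p q ⟩
      extendProfile (gaps T x) c p q      ≡⟨ extendProfile-gaps 2T'≤T x c (valid-noUnderflow c valid) p q ⟩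
      gaps T' (extend (value x c) x) p q  ≡⟨ SameGaps-extend same p q ⟩
      gaps T' (extend (toℕ a) x) p q      ≡⟨ gaps-cong T' (position-extend m a ρ) p q ⟨
      gaps T' (position m (extend a ρ)) p q ∎
      where open ≡-Reasoning

quantifierRank : ∀ {k} → Formula k → ℕ
quantifierRank (x ≐ y) = 0
quantifierRank (x ⋖ y) = 0
quantifierRank (¬ᶠ φ) = quantifierRank φ
quantifierRank (φ ∧ᶠ ψ) = quantifierRank φ ⊔ quantifierRank ψ
quantifierRank (φ ∨ᶠ ψ) = quantifierRank φ ⊔ quantifierRank ψ
quantifierRank (∃ᶠ φ) = suc (quantifierRank φ)
quantifierRank (∀ᶠ φ) = suc (quantifierRank φ)

-- Quantifiers beyond rank q are never reached, so their value at q = 0 is arbitrary.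
GapSat : ℕ → ∀ {k} → Formula k → Profile (k + 2) → Set
GapSat q (x ≐ y) D = D (var x) (var y) ≡ 0 × D (var y) (var x) ≡ 0
GapSat q (x ⋖ y) D = 0 < D (var x) (var y)
GapSat q (¬ᶠ φ) D = ¬ GapSat q φ D
GapSat q (φ ∧ᶠ ψ) D = GapSat q φ D × GapSat q ψ D
GapSat q (φ ∨ᶠ ψ) D = GapSat q φ D ⊎ GapSat q ψ D
GapSat zero (∃ᶠ φ) D = ⊥
GapSat (suc q) {k} (∃ᶠ φ) D = Σ (Candidate (k + 2) (2 ^ q)) λ c → Valid D c × GapSat q φ (extendProfile D c)
GapSat zero (∀ᶠ φ) D = ⊥
GapSat (suc q) {k} (∀ᶠ φ) D = (c : Candidate (k + 2) (2 ^ q)) → Valid D c → GapSat q φ (extendProfile D c)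

dir-any? : ∀ {P : Dir → Set} → (∀ s → Dec (P s)) → Dec (∃ P)
dir-any? P? = map′ [ (↑ ,_) , (↓ ,_) ]′ (λ { (↑ , h) → inj₁ h ; (↓ , h) → inj₂ h }) (P? ↑ ⊎-dec P? ↓)

dir-all? : ∀ {P : Dir → Set} → (∀ s → Dec (P s)) → Dec (∀ s → P s)
dir-all? P? = map′ (λ { (h↑ , h↓) ↑ → h↑ ; (h↑ , h↓) ↓ → h↓ }) (λ h → h ↑ , h ↓) (P? ↑ ×-dec P? ↓)

candidate-any? : ∀ {n T} {P : Candidate n T → Set} → (∀ c → Dec (P c)) → Dec (∃ P)
candidate-any? P? = map′ (λ { (p , d , s , h) → (p , d , s) , h }) (λ { ((p , d , s) , h) → p , d , s , h })
  (any? λ p → any? λ d → dir-any? λ s → P? (p , d , s))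

candidate-all? : ∀ {n T} {P : Candidate n T → Set} → (∀ c → Dec (P c)) → Dec (∀ c → P c)
candidate-all? P? = map′ (λ h (p , d , s) → h p d s) (λ h p d s → h (p , d , s))
  (all? λ p → all? λ d → dir-all? λ s → P? (p , d , s))

gapSat? : ∀ q {k} (φ : Formula k) (D : Profile (k + 2)) → Dec (GapSat q φ D)
gapSat? q (x ≐ y) D = (D (var x) (var y) ≟ 0) ×-dec (D (var y) (var x) ≟ 0)
gapSat? q (x ⋖ y) D = 0 <? D (var x) (var y)
gapSat? q (¬ᶠ φ) D = ¬? (gapSat? q φ D)
gapSat? q (φ ∧ᶠ ψ) D = gapSat? q φ D ×-dec gapSat? q ψ D
gapSat? q (φ ∨ᶠ ψ) D = gapSat? q φ D ⊎-dec gapSat? q ψ D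
gapSat? zero (∃ᶠ φ) D = no λ ()
gapSat? (suc q) (∃ᶠ φ) D = candidate-any? λ c → valid? D c ×-dec gapSat? q φ (extendProfile D c)
gapSat? zero (∀ᶠ φ) D = no λ ()
gapSat? (suc q) (∀ᶠ φ) D = candidate-all? λ c → valid? D c →-dec gapSat? q φ (extendProfile D c)

⊓≡0⇔ : ∀ {T} z → 0 < T → T ⊓ z ≡ 0 ⇔ z ≡ 0
⊓≡0⇔ {suc T} zero _ = mk⇔ id id
⊓≡0⇔ {suc T} (suc z) _ = mk⇔ (λ ()) (λ ())

0<⊓⇔ : ∀ {T} z → 0 < T → 0 < T ⊓ z ⇔ 0 < z
0<⊓⇔ {suc T} zero _ = mk⇔ id id
0<⊓⇔ {suc T} (suc z) _ = mk⇔ (λ _ → z<s) (λ _ → z<s)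

≡⇔clipped-gaps≡0 : ∀ {T n} (a b : Fin n) → 0 < T →
                   a ≡ b ⇔ (T ⊓ (toℕ b ∸ toℕ a) ≡ 0 × T ⊓ (toℕ a ∸ toℕ b) ≡ 0)
≡⇔clipped-gaps≡0 {T} a b 0<T = mk⇔
  (λ { refl → clipped≡0 (n∸n≡0 (toℕ a)) , clipped≡0 (n∸n≡0 (toℕ a)) })
  (λ (b≤a , a≤b) → toℕ-injective (≤-antisym (m∸n≡0⇒m≤n (unclipped≡0 a≤b)) (m∸n≡0⇒m≤n (unclipped≡0 b≤a))))
  where
  clipped≡0 : ∀ {z} → z ≡ 0 → T ⊓ z ≡ 0
  clipped≡0 = Equivalence.from (⊓≡0⇔ _ 0<T)
  unclipped≡0 : ∀ {z} → T ⊓ z ≡ 0 → z ≡ 0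
  unclipped≡0 = Equivalence.to (⊓≡0⇔ _ 0<T)

<ᵇ⇔0<clipped-gap : ∀ {T} a b → 0 < T → (a <ᵇ b) ≡ true ⇔ 0 < T ⊓ (b ∸ a)
<ᵇ⇔0<clipped-gap a b 0<T = ⇔-trans (mk⇔ to from) (⇔-sym (0<⊓⇔ (b ∸ a) 0<T))
  where
  to : (a <ᵇ b) ≡ true → 0 < b ∸ a
  to a<ᵇb = m<n⇒0<n∸m (<ᵇ⇒< a b (Equivalence.from T-≡ a<ᵇb))
  from : 0 < b ∸ a → (a <ᵇ b) ≡ true
  from 0<b∸a = Equivalence.to T-≡ (<⇒<ᵇ (m∸n≢0⇒n<m {b} {a} (n>0⇒n≢0 0<b∸a)))

gap-var : ∀ m {k T} (ρ : Fin k → Fin (suc m)) {D : Profile (k + 2)} → D ≗₂ gaps T (position m ρ) →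
          ∀ x y → D (var x) (var y) ≡ T ⊓ (toℕ (ρ y) ∸ toℕ (ρ x))
gap-var m {T = T} ρ D≗gaps x y =
  trans (D≗gaps (var x) (var y)) (cong₂ (λ a b → T ⊓ (a ∸ b)) (position-var m ρ y) (position-var m ρ x))

2^q-doubling : ∀ q → 2 ^ q + 2 ^ q ≤ 2 ^ suc q
2^q-doubling q = ≤-reflexive (cong (2 ^ q +_) (sym (+-identityʳ (2 ^ q))))

Sat⇔GapSat : ∀ q {k} (φ : Formula k) → quantifierRank φ ≤ q → ∀ m (ρ : Fin k → Fin (suc m)) (D : Profile (k + 2)) →
             D ≗₂ gaps (2 ^ q) (position m ρ) → Sat m ρ φ ⇔ GapSat q φ D
Sat⇔GapSat q (x ≐ y) _ m ρ D D≗gaps rewrite gap-var m ρ D≗gaps x y | gap-var m ρ D≗gaps y x =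
  ≡⇔clipped-gaps≡0 (ρ x) (ρ y) (m^n>0 2 q)
Sat⇔GapSat q (x ⋖ y) _ m ρ D D≗gaps rewrite gap-var m ρ D≗gaps x y =
  <ᵇ⇔0<clipped-gap (toℕ (ρ x)) (toℕ (ρ y)) (m^n>0 2 q)
Sat⇔GapSat q (¬ᶠ φ) r m ρ D D≗gaps = ¬-cong-⇔ (Sat⇔GapSat q φ r m ρ D D≗gaps)
Sat⇔GapSat q (φ ∧ᶠ ψ) r m ρ D D≗gaps =
  Sat⇔GapSat q φ (m⊔n≤o⇒m≤o _ _ r) m ρ D D≗gaps ×-⇔ Sat⇔GapSat q ψ (m⊔n≤o⇒n≤o _ _ r) m ρ D D≗gaps
Sat⇔GapSat q (φ ∨ᶠ ψ) r m ρ D D≗gaps =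
  Sat⇔GapSat q φ (m⊔n≤o⇒m≤o _ _ r) m ρ D D≗gaps ⊎-⇔ Sat⇔GapSat q ψ (m⊔n≤o⇒n≤o _ _ r) m ρ D D≗gaps
Sat⇔GapSat (suc q) (∃ᶠ φ) (s≤s r) m ρ D D≗gaps = mk⇔
  (λ (a , sat) → let c , valid , ≗gaps = point→candidate m ρ (2^q-doubling q) D≗gaps a
                 in c , valid , Equivalence.to (IH (extend a ρ) (extendProfile D c) ≗gaps) sat)
  (λ (c , valid , gapSat) → let a , ≗gaps = candidate→point m ρ (2^q-doubling q) D≗gaps c valid
                            in a , Equivalence.from (IH (extend a ρ) (extendProfile D c) ≗gaps) gapSat)
  where IH = Sat⇔GapSat q φ r m
Sat⇔GapSat (suc q) (∀ᶠ φ) (s≤s r) m ρ D D≗gaps = mk⇔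
  (λ sat c valid → let a , ≗gaps = candidate→point m ρ (2^q-doubling q) D≗gaps c valid
                   in Equivalence.to (IH (extend a ρ) (extendProfile D c) ≗gaps) (sat a))
  (λ gapSat a → let c , valid , ≗gaps = point→candidate m ρ (2^q-doubling q) D≗gaps a
                in Equivalence.from (IH (extend a ρ) (extendProfile D c) ≗gaps) (gapSat c valid))
  where IH = Sat⇔GapSat q φ r m

count : ∀ T → (Fin T → Bool) → ℕ
count zero g = 0
count (suc T) g = (if g fz then 1 else 0) + count T (g ∘ fs)

count-<ᵇ : ∀ T X (g : Fin T → Bool) → (∀ e → g e ≡ (toℕ e <ᵇ X)) → count T g ≡ T ⊓ X
count-<ᵇ zero X g _ = refl
count-<ᵇ (suc T) zero g g≡ rewrite g≡ fz = trans (count-<ᵇ T 0 (g ∘ fs) (g≡ ∘ fs)) (⊓-zeroʳ T)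
count-<ᵇ (suc T) (suc X) g g≡ rewrite g≡ fz = cong suc (count-<ᵇ T X (g ∘ fs) (g≡ ∘ fs))

m+n<ᵇo≡n<ᵇo∸m : ∀ m n o → (m + n <ᵇ o) ≡ (n <ᵇ o ∸ m)
m+n<ᵇo≡n<ᵇo∸m zero n o = refl
m+n<ᵇo≡n<ᵇo∸m (suc m) n zero = refl
m+n<ᵇo≡n<ᵇo∸m (suc m) n (suc o) = m+n<ᵇo≡n<ᵇo∸m m n o

not[m<ᵇ1+n]≡n<ᵇm : ∀ m n → not (m <ᵇ suc n) ≡ (n <ᵇ m)
not[m<ᵇ1+n]≡n<ᵇm zero n = refl
not[m<ᵇ1+n]≡n<ᵇm (suc m) zero = refl
not[m<ᵇ1+n]≡n<ᵇm (suc m) (suc n) = not[m<ᵇ1+n]≡n<ᵇm m n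

-- The numbers encoding a label: its points shifted by 0,…,T, and its own T-clipped gaps.
Slot : ℕ → ℕ → Set
Slot k T = (Point k × Fin (suc T)) ⊎ (Point k × Point k)

pattern shifted p e = inj₁ (p , e)
pattern gap p q = inj₂ (p , q)

slotValue : ∀ m {k} T → (Fin k → Fin (suc m)) → Slot k T → ℕ
slotValue m T a (shifted p e) = position m a p + toℕ e
slotValue m T a (gap p q) = gaps T (position m a) p q

slotValue-≤ : ∀ m {k} T (a : Fin k → Fin (suc m)) s → slotValue m T a s ≤ m + T
slotValue-≤ m T a (shifted p e) = +-mono-≤ (position-≤ m a p) (toℕ≤pred[n] e)
slotValue-≤ m T a (gap p q) = ≤-trans (m⊓n≤m T _) (m≤n+m T m)

slotCount : ℕ → ℕ → ℕ
slotCount k T = (k + 2) * suc T + (k + 2) * (k + 2)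

slots : ∀ k T → Fin (slotCount k T) ↔ Slot k T
slots k T = ↔-trans +↔⊎ (*↔× ⊎-↔ *↔×)

-- The points of a pair of labels: u's variables and the shared endpoints on the left, v's variables on the right.
side : ∀ {k} → Point (k + k) → Point k ⊎ Point k
side {k} P = [ [ inj₁ ∘ var , inj₂ ∘ var ]′ ∘ splitAt k , inj₁ ∘ (k ↑ʳ_) ]′ (splitAt (k + k) P)

position-side : ∀ m {k} (a b : Fin k → Fin (suc m)) P →
                position m (pairEnv k a b) P ≡ [ position m a , position m b ]′ (side P)
position-side m {k} a b P with splitAt (k + k) P
... | inj₂ e = sym (position-endpoint m a e)
... | inj₁ i with splitAt k i
...   | inj₁ x = sym (position-var m a x)
...   | inj₂ y = sym (position-var m b y)

-- Each clipped gap is the number of e < T for which a comparison between a slot of u and a slot of v succeeds.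
decodeSides : ∀ {k} T → (Slot k T → Slot k T → Bool) → Point k ⊎ Point k → Point k ⊎ Point k → ℕ
decodeSides T M (inj₁ x) (inj₁ y) = count T λ e → not (M (gap x y) (shifted bottom (fs e)))
decodeSides T M (inj₂ x) (inj₂ y) = count T λ e → M (shifted bottom (inject₁ e)) (gap x y)
decodeSides T M (inj₁ x) (inj₂ y) = count T λ e → M (shifted x (inject₁ e)) (shifted y fz)
decodeSides T M (inj₂ x) (inj₁ y) = count T λ e → not (M (shifted y fz) (shifted x (fs e)))

decode : ∀ {k} T → (Slot k T → Slot k T → Bool) → Profile (k + k + 2)
decode T M P Q = decodeSides T M (side P) (side Q)

module _ (m : ℕ) {k : ℕ} (T : ℕ) (a b : Fin k → Fin (suc m)) (M : Slot k T → Slot k T → Bool)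
         (M≡ : ∀ s s' → M s s' ≡ (slotValue m T a s <ᵇ slotValue m T b s')) where

  private
    x : Point k ⊎ Point k → ℕ
    x = [ position m a , position m b ]′

    shifted-bottom : ∀ (c : Fin k → Fin (suc m)) n → slotValue m T c (shifted bottom n) ≡ toℕ n
    shifted-bottom c n = cong (_+ toℕ n) (position-bottom m c)

  decodeSides-correct : ∀ s t → decodeSides T M s t ≡ T ⊓ (x t ∸ x s)
  decodeSides-correct (inj₁ p) (inj₁ q) = trans (count-<ᵇ T (gaps T (position m a) p q) _ λ e →
      trans (cong not (trans (M≡ _ _) (cong (gaps T (position m a) p q <ᵇ_) (shifted-bottom b (fs e)))))
            (not[m<ᵇ1+n]≡n<ᵇm (gaps T (position m a) p q) (toℕ e)))
    (⊓-⊓-absorb _ ≤-refl)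
  decodeSides-correct (inj₂ p) (inj₂ q) = trans (count-<ᵇ T (gaps T (position m b) p q) _ λ e →
      trans (M≡ _ _) (cong (_<ᵇ gaps T (position m b) p q) (trans (shifted-bottom a (inject₁ e)) (toℕ-inject₁ e))))
    (⊓-⊓-absorb _ ≤-refl)
  decodeSides-correct (inj₁ p) (inj₂ q) = count-<ᵇ T (y ∸ z) _ λ e → begin
    M (shifted p (inject₁ e)) (shifted q fz)  ≡⟨ M≡ _ _ ⟩
    z + toℕ (inject₁ e) <ᵇ y + 0             ≡⟨ cong₂ (λ n o → z + n <ᵇ o) (toℕ-inject₁ e) (+-identityʳ y) ⟩
    z + toℕ e <ᵇ y                           ≡⟨ m+n<ᵇo≡n<ᵇo∸m z (toℕ e) y ⟩
    toℕ e <ᵇ y ∸ z                           ∎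
    where
    open ≡-Reasoning
    y = position m b q
    z = position m a p
  decodeSides-correct (inj₂ p) (inj₁ q) = count-<ᵇ T (y ∸ z) _ λ e → begin
    not (M (shifted q fz) (shifted p (fs e)))  ≡⟨ cong not (M≡ _ _) ⟩
    not (y + 0 <ᵇ z + suc (toℕ e))            ≡⟨ cong₂ (λ n o → not (n <ᵇ o)) (+-identityʳ y) (+-suc z (toℕ e)) ⟩
    not (y <ᵇ suc (z + toℕ e))                ≡⟨ not[m<ᵇ1+n]≡n<ᵇm y (z + toℕ e) ⟩
    z + toℕ e <ᵇ y                            ≡⟨ m+n<ᵇo≡n<ᵇo∸m z (toℕ e) y ⟩
    toℕ e <ᵇ y ∸ z                            ∎
    where
    open ≡-Reasoning
    y = position m a q
    z = position m b p

  decode-correct : decode T M ≗₂ gaps T (position m (pairEnv k a b))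
  decode-correct P Q = trans (decodeSides-correct (side P) (side Q))
                             (sym (cong₂ (λ y z → T ⊓ (y ∸ z)) (position-side m a b Q) (position-side m a b P)))

lookup-rowsOf : ∀ {k} (A : Fin k → Fin k → Bool) i j → lookup (rowsOf A) (combine i j) ≡ A i j
lookup-rowsOf A i j = begin
  lookup (rowsOf A) (combine i j)                         ≡⟨ lookup-concat (tabulate λ i → tabulate (A i)) i j ⟩
  lookup (lookup (tabulate λ i → tabulate (A i)) i) j     ≡⟨ cong (λ row → lookup row j) (lookup∘tabulate (λ i → tabulate (A i)) i) ⟩
  lookup (tabulate (A i)) j                               ≡⟨ lookup∘tabulate (A i) j ⟩
  A i j                                                   ∎
  where open ≡-Reasoning

does≡true⇔ : ∀ {A : Set} (a? : Dec A) → does a? ≡ true ⇔ A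
does≡true⇔ (yes a) = mk⇔ (λ _ → a) (λ _ → refl)
does≡true⇔ (no ¬a) = mk⇔ (λ ()) (λ a → ⊥-elim (¬a a))

clampFin : ∀ {N} → 0 < N → ℕ → Fin N
clampFin {suc N} _ x = fromℕ< (s≤s (m⊓n≤n x N))

toℕ-clampFin : ∀ {N} (0<N : 0 < N) x → x < N → toℕ (clampFin 0<N x) ≡ x
toℕ-clampFin {suc N} _ x x<N = trans (toℕ-fromℕ< (s≤s (m⊓n≤n x N))) (m≤n⇒m⊓n≡m (s≤s⁻¹ x<N))

inhabited⇒^>0 : ∀ {n} → Fin n → ∀ e → 0 < n ^ e
inhabited⇒^>0 {suc n} _ e = m^n>0 (suc n) e

distinct⇒2≤ : ∀ {n} (u v : Fin n) → u ≢ v → 2 ≤ n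
distinct⇒2≤ {suc zero} fz fz u≢v = ⊥-elim (u≢v refl)
distinct⇒2≤ {suc (suc n)} _ _ _ = s≤s (s≤s z≤n)

<-*ˡ : ∀ {n y} → 2 ≤ n → 0 < y → y < n * y
<-*ˡ {suc zero} (s≤s ())
<-*ˡ {suc (suc n)} {y} _ 0<y = m<m+n y (<-≤-trans 0<y (m≤m+n y (n * y)))

^-+-growth : ∀ {n} → 2 ≤ n → ∀ c j → n ^ c + j < n ^ (suc j + c)
^-+-growth {suc zero} (s≤s ())
^-+-growth {n@(suc (suc _))} 2≤n c zero =
  subst (_< n ^ (1 + c)) (sym (+-identityʳ (n ^ c))) (<-*ˡ 2≤n (m^n>0 n c))
^-+-growth {n@(suc (suc _))} 2≤n c (suc j) =
  subst (_< n ^ (2 + j + c)) (sym (+-suc (n ^ c) j)) (≤-<-trans (^-+-growth 2≤n c j) (<-*ˡ 2≤n (m^n>0 n (suc j + c))))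

module Reduction {k : ℕ} (φ : Formula (k + k)) (c : ℕ) where

  q t K exponent : ℕ
  q = quantifierRank φ
  t = 2 ^ q
  K = slotCount k t
  exponent = suc t + c

  slotOf : Fin K → Slot k t
  slotOf = Inverse.to (slots k t)

  indexOf : Slot k t → Fin K
  indexOf = Inverse.from (slots k t)

  readProfile : Vec Bool (K * K) → Profile (k + k + 2)
  readProfile entries = decode t λ s s' → lookup entries (combine (indexOf s) (indexOf s'))

  readEdge : Vec Bool (K * K) → Bool
  readEdge entries = does (gapSat? q φ (readProfile entries))

  representation : ∀ G → InGr φ c G → HasRep G (D (size G ^ exponent)) K readEdge
  representation G (ℓ , ℓ-correct) = ℓ′ , λ u v u≢v →
    ⇔-trans (ℓ-correct u v)
    (⇔-trans (Sat⇔GapSat q φ ≤-refl m (pairEnv k (ℓ u) (ℓ v)) _ (readProfile-correct u v u≢v))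
             (⇔-sym (does≡true⇔ (gapSat? q φ _))))
    where
    n m N : ℕ
    n = size G
    m = n ^ c
    N = n ^ exponent

    ℓ′ : Fin n → Fin K → Fin N
    ℓ′ u i = clampFin (inhabited⇒^>0 u exponent) (slotValue m t (ℓ u) (slotOf i))

    toℕ-ℓ′ : ∀ u → 2 ≤ n → ∀ s → toℕ (ℓ′ u (indexOf s)) ≡ slotValue m t (ℓ u) s
    toℕ-ℓ′ u 2≤n s = begin
      toℕ (ℓ′ u (indexOf s))                ≡⟨ toℕ-clampFin _ _ (≤-<-trans (slotValue-≤ m t (ℓ u) (slotOf (indexOf s))) (^-+-growth 2≤n c t)) ⟩
      slotValue m t (ℓ u) (slotOf (indexOf s))  ≡⟨ cong (slotValue m t (ℓ u)) (Inverse.strictlyInverseˡ (slots k t) s) ⟩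
      slotValue m t (ℓ u) s                     ∎
      where open ≡-Reasoning

    readProfile-correct : ∀ u v → u ≢ v → readProfile (rowsOf λ i j → edge (D N) (ℓ′ u i) (ℓ′ v j)) ≗₂
                                           gaps t (position m (pairEnv k (ℓ u) (ℓ v)))
    readProfile-correct u v u≢v = decode-correct m t (ℓ u) (ℓ v) _ λ s s' →
      trans (lookup-rowsOf (λ i j → edge (D N) (ℓ′ u i) (ℓ′ v j)) (indexOf s) (indexOf s'))
            (cong₂ _<ᵇ_ (toℕ-ℓ′ u 2≤n s) (toℕ-ℓ′ v 2≤n s'))
      where 2≤n = distinct⇒2≤ u v u≢v

InGFO⇒≤sg-D : ∀ {C} → InGFO C → C ≤sg DClass
InGFO⇒≤sg-D (k , φ , c , C⊆gr) = exponent , K , readEdge ,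
  λ G CG → D (size G ^ exponent) , (size G ^ exponent , ↔-refl , λ _ _ → refl) , refl , representation G (C⊆gr G CG)
  where open Reduction {k} φ c

D∈GFO : InGFO DClass
D∈GFO = 1 , fz ⋖ fs fz , 1 , labelling
  where
  labelling : ∀ G → DClass G → InGr {1} (fz ⋖ fs fz) 1 G
  labelling G (n , G≅Dn , edge≡) = ℓ , λ u v → mk⇔ (trans (sym (edge≡′ u v))) (trans (edge≡′ u v))
    where
    index = Inverse.to G≅Dn
    bound : ∀ u → toℕ (index u) < suc (size G ^ 1)
    bound u = s≤s (≤-trans (<⇒≤ (subst (toℕ (index u) <_) (sym (↔⇒≡ G≅Dn)) (toℕ<n (index u))))
                           (≤-reflexive (sym (*-identityʳ (size G)))))
    ℓ : Fin (size G) → Fin 1 → Fin (suc (size G ^ 1))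
    ℓ u _ = fromℕ< (bound u)
    edge≡′ : ∀ u v → edge G u v ≡ (toℕ (ℓ u fz) <ᵇ toℕ (ℓ v fz))
    edge≡′ u v = trans (edge≡ u v) (sym (cong₂ _<ᵇ_ (toℕ-fromℕ< (bound u)) (toℕ-fromℕ< (bound v))))

theorem6p24 : InGFO DClass × ((C : Graph → Set) → IsGraphClass C → InGFO C → C ≤sg DClass)
theorem6p24 = D∈GFO , λ C _ → InGFO⇒≤sg-D
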